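{- Let $\mathcal{Q}$ be an abstract polyhedron, $\Phi$ a flag of $\mathcal{Q}$, and $\Gamma=\langle\rho_0,\rho_1,\rho_2\rangle$ a string C-group of rank $3$ admitting a flag action on $\mathcal{Q}$. Let $i\in\{0,1\}$, $q$ an integer and $w\in\Gamma$. If $w(\rho_i\rho_{i+1})^q w^{ -1}\in\mathrm{Stab}_\Gamma(\Phi)$, then $w'(\rho_i\rho_{i+1})^q w'^{ -1}\in\mathrm{Stab}_\Gamma(\Phi)$ for every $w'\in\Gamma$ such that the flags $\Phi^{w'}$ and $\Phi^{w}$ have the same face (rank-$2$ element) if $i=0$, and the same vertex if $i=1$.
   Context: An abstract polyhedron is an abstract polytope of rank $3$ (vertices, edges, faces of ranks $0,1,2$; flags are maximal chains; diamond condition holds). For a flag $\Psi$ and $j\in\{0,1,2\}$, $\Psi^j$ is the unique flag differing from $\Psi$ exactly in its rank-$j$ face. A string C-group of rank 3 is a group generated by involutions $\rho_0,\rho_1,\rho_2$ with $(\rho_0\rho_2)^2=\varepsilon$ and $\langle\rho_0,\rho_1\rangle\cap\langle\rho_1,\rho_2\rangle=\langle\rho_1\rangle$. A flag action of $\Gamma$ on $\mathcal{Q}$ is a homomorphism from $\Gamma$ into the permutations of flags with $\rho_j$ acting by $\Psi\mapsto\Psi^j$, written as a right action: $\Psi^{w\rho_j}=(\Psi^w)^j$. $\mathrm{Stab}_\Gamma(\Phi)=\{g\in\Gamma:\Phi^g=\Phi\}$. -}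

module Defs where

open import Level using (Level; _⊔_)
open import Data.Fin using (Fin; zero; suc; inject₁)
open import Data.Integer as ℤ using (ℤ; +_; -[1+_]; -1ℤ; 0ℤ; 1ℤ)
import Data.Integer.Properties as ℤP
open import Data.Nat using (ℕ)
import Data.Unit
open import Data.Product using (Σ; ∃; ∃-syntax; _×_; _,_)
open import Data.Sum using (_⊎_)
open import Relation.Binary.PropositionalEquality using (_≡_)
open import Relation.Binary.Structures using (IsPartialOrder)
open import Relation.Nullary using (¬_)
open import Algebra.Bundles using (Group)

record RankedPoset3 (a b : Level) : Set (Level.suc (a ⊔ b)) where
  field
    Face       : Set a
    _≤_        : Face → Face → Set b
    isPartialOrder : IsPartialOrder _≡_ _≤_
    rank       : Face → ℤ
    rank-lower : ∀ F → -1ℤ ℤ.≤ rank F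
    rank-upper : ∀ F → rank F ℤ.≤ + 3
    least      : Face
    least-≤    : ∀ F → least ≤ F
    greatest   : Face
    ≤-greatest : ∀ F → F ≤ greatest
    rank-least    : rank least ≡ -1ℤ
    rank-greatest : rank greatest ≡ + 3
    rank-strict : ∀ {F G} → F ≤ G → ¬ (F ≡ G) → rank F ℤ.< rank G
    -- gradedness: every interval contains faces of all intermediate ranks
    -- (equivalently, all maximal chains contain exactly one face of each rank)
    graded : ∀ {F G} → F ≤ G → ∀ k → rank F ℤ.≤ k → k ℤ.≤ rank G →
             ∃[ H ] (F ≤ H × H ≤ G × rank H ≡ k)

module _ {a b} (P : RankedPoset3 a b) where
  open RankedPoset3 P

  -- A flag (maximal chain F₋₁ < F₀ < F₁ < F₂ < F₃); F₋₁ and F₃ are implicit.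
  record Flag : Set (a ⊔ b) where
    constructor mkFlag
    field
      vertex : Face
      edge   : Face
      face   : Face
      rank-vertex : rank vertex ≡ + 0
      rank-edge   : rank edge ≡ + 1
      rank-face   : rank face ≡ + 2
      vertex≤edge : vertex ≤ edge
      edge≤face   : edge ≤ face
  open Flag public

  faceOf : Flag → Fin 3 → Face
  faceOf Ψ zero             = vertex Ψ
  faceOf Ψ (suc zero)       = edge Ψ
  faceOf Ψ (suc (suc zero)) = face Ψ

  _≈F_ : Flag → Flag → Set a
  Ψ ≈F Ω = ∀ j → faceOf Ψ j ≡ faceOf Ω j

  InFlag : Flag → Face → Set a
  InFlag Ψ H = H ≡ least ⊎ H ≡ vertex Ψ ⊎ H ≡ edge Ψ ⊎ H ≡ face Ψ ⊎ H ≡ greatest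

  Adj : Fin 3 → Flag → Flag → Set a
  Adj j Ψ Ω = ¬ (faceOf Ψ j ≡ faceOf Ω j) × (∀ k → ¬ (k ≡ j) → faceOf Ψ k ≡ faceOf Ω k)

  data FlagPath (S : Face → Set a) : Flag → Flag → Set (a ⊔ b) where
    done : ∀ {Ψ Ω} → Ψ ≈F Ω → FlagPath S Ψ Ω
    step : ∀ {Ψ Ψ' Ω} (j : Fin 3) → Adj j Ψ Ψ' →
           (∀ H → S H → InFlag Ψ' H) → FlagPath S Ψ' Ω → FlagPath S Ψ Ω

  record IsPolyhedron : Set (Level.suc a ⊔ b) where
    field
      diamond : ∀ {F G} → F ≤ G → rank G ≡ rank F ℤ.+ + 2 →
        ∃[ H₁ ] ∃[ H₂ ] (¬ (H₁ ≡ H₂)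
          × (F ≤ H₁ × H₁ ≤ G × rank H₁ ≡ rank F ℤ.+ 1ℤ)
          × (F ≤ H₂ × H₂ ≤ G × rank H₂ ≡ rank F ℤ.+ 1ℤ)
          × (∀ H → F ≤ H → H ≤ G → rank H ≡ rank F ℤ.+ 1ℤ → H ≡ H₁ ⊎ H ≡ H₂))
      stronglyFlagConnected : ∀ Ψ Ω →
        FlagPath (λ H → InFlag Ψ H × InFlag Ω H) Ψ Ω

record AbstractPolyhedron (a b : Level) : Set (Level.suc (a ⊔ b)) where
  field
    poset        : RankedPoset3 a b
    isPolyhedron : IsPolyhedron poset
  open RankedPoset3 poset public

module _ {c ℓ} (G : Group c ℓ) where
  open Group G

  _^ℕ_ : Carrier → ℕ → Carrier
  x ^ℕ ℕ.zero  = ε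
  x ^ℕ ℕ.suc n = x ^ℕ n ∙ x

  _^ℤ_ : Carrier → ℤ → Carrier
  x ^ℤ (+ n)      = x ^ℕ n
  x ^ℤ (-[1+ n ]) = (x ⁻¹) ^ℕ ℕ.suc n

  data Gen (ρ : Fin 3 → Carrier) (J : Fin 3 → Set) : Carrier → Set (c ⊔ ℓ) where
    gen  : ∀ j → J j → Gen ρ J (ρ j)
    unit : Gen ρ J ε
    mul  : ∀ {x y} → Gen ρ J x → Gen ρ J y → Gen ρ J (x ∙ y)
    inv  : ∀ {x} → Gen ρ J x → Gen ρ J (x ⁻¹)
    resp : ∀ {x y} → x ≈ y → Gen ρ J x → Gen ρ J y

record StringCGroup3 (c ℓ : Level) : Set (Level.suc (c ⊔ ℓ)) where
  field
    group : Group c ℓ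
  open Group group public
  field
    ρ : Fin 3 → Carrier
    ρ-invol    : ∀ j → ρ j ∙ ρ j ≈ ε
    ρ-nontriv  : ∀ j → ¬ (ρ j ≈ ε)
    generated  : ∀ g → Gen group ρ (λ _ → Data.Unit.⊤) g
    string     : (ρ zero ∙ ρ (suc (suc zero))) ∙ (ρ zero ∙ ρ (suc (suc zero))) ≈ ε
    intersection : ∀ g →
      Gen group ρ (λ j → j ≡ zero ⊎ j ≡ suc zero) g →
      Gen group ρ (λ j → j ≡ suc zero ⊎ j ≡ suc (suc zero)) g →
      Gen group ρ (λ j → j ≡ suc zero) g

record FlagAction {a b c ℓ} (Q : AbstractPolyhedron a b) (Γ : StringCGroup3 c ℓ)
       : Set (a ⊔ b ⊔ c ⊔ ℓ) where
  open AbstractPolyhedron Q using (poset)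
  open StringCGroup3 Γ
  field
    _^_      : Flag poset → Carrier → Flag poset
    act-cong : ∀ {Ψ Ω g h} → _≈F_ poset Ψ Ω → g ≈ h → _≈F_ poset (Ψ ^ g) (Ω ^ h)
    act-ε    : ∀ Ψ → _≈F_ poset (Ψ ^ ε) Ψ
    act-∙    : ∀ Ψ g h → _≈F_ poset (Ψ ^ (g ∙ h)) ((Ψ ^ g) ^ h)
    act-ρ    : ∀ Ψ j → Adj poset j Ψ (Ψ ^ ρ j)

module _ {a b c ℓ} {Q : AbstractPolyhedron a b} {Γ : StringCGroup3 c ℓ}
         (A : FlagAction Q Γ) where
  open AbstractPolyhedron Q using (poset)
  open StringCGroup3 Γ
  open FlagAction A

  Stab : Flag poset → Carrier → Set a
  Stab Φ g = _≈F_ poset (Φ ^ g) Φ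

ρρ : ∀ {c ℓ} (Γ : StringCGroup3 c ℓ) → Fin 2 → StringCGroup3.Carrier Γ
ρρ Γ i = ρ (inject₁ i) ∙ ρ (suc i)
  where open StringCGroup3 Γ

SharedFace : ∀ {a b} (Q : AbstractPolyhedron a b) → Fin 2 →
             Flag (AbstractPolyhedron.poset Q) → Flag (AbstractPolyhedron.poset Q) → Set a
SharedFace Q zero       Ψ Ω = face Ψ ≡ face Ω
SharedFace Q (suc zero) Ψ Ω = vertex Ψ ≡ vertex Ω

-- Put x = (ρᵢρᵢ₊₁)^q and let k be the rank of the face F shared by Φ^w and Φ^w'
-- (k = 2 for i = 0, k = 0 for i = 1).  Each ρⱼ with j ≠ k is an involution inverting
-- ρᵢρᵢ₊₁, hence inverting x, so x fixing a flag Ψ forces (Ψ^j)^x = (Ψ^(x⁻¹))^j = Ψ^j.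
-- By hypothesis x fixes Φ^w, and strong flag-connectivity joins Φ^w to Φ^w' through
-- adjacent flags that all contain F; no step of such a path changes the rank-k face,
-- so x fixes Φ^w' as well.  Conjugating back by w' gives the claim.

module Submission where

open import Defs
open import Level using (_⊔_)
open import Algebra.Bundles using (Group)
open import Data.Empty using (⊥-elim)
open import Data.Fin using (Fin; zero; suc; toℕ; _≟_)
open import Data.Fin.Properties using (toℕ-injective; toℕ<n)
open import Data.Integer as ℤ using (ℤ; +_; -[1+_]; 1ℤ)
open import Data.Integer.Properties using (+-injective)
open import Data.Nat using (ℕ)
open import Data.Nat.Properties using (<-irrefl)
open import Data.Product using (_×_; _,_; proj₁; proj₂)
open import Data.Sum using (inj₁; inj₂)
open import Relation.Binary.Bundles using (Setoid)
open import Relation.Binary.Structures using (IsEquivalence; IsPartialOrder)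
open import Relation.Binary.PropositionalEquality
  using (_≡_; _≢_; refl; sym; trans; cong; subst; subst₂)
open import Relation.Nullary using (yes; no)
import Algebra.Properties.Group as GroupProperties
import Relation.Binary.Reasoning.Setoid as SetoidReasoning

module _ {c ℓ} (G : Group c ℓ) where
  open Group G renaming (sym to ≈-sym) hiding (trans)
  open GroupProperties G
  open SetoidReasoning setoid

  private
    _^ₙ_ : Carrier → ℕ → Carrier
    _^ₙ_ = _^ℕ_ G

  Inverts : Carrier → Carrier → Set ℓ
  Inverts p x = p ∙ x ≈ x ⁻¹ ∙ p

  ^ℕ-intertwine : ∀ {p x y} → p ∙ x ≈ y ∙ p → ∀ n → p ∙ x ^ₙ n ≈ y ^ₙ n ∙ p
  ^ℕ-intertwine {p} _ ℕ.zero = begin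
    p ∙ ε ≈⟨ identityʳ p ⟩
    p     ≈⟨ identityˡ p ⟨
    ε ∙ p ∎
  ^ℕ-intertwine {p} {x} {y} px≈yp (ℕ.suc n) = begin
    p ∙ (x ^ₙ n ∙ x)   ≈⟨ assoc p _ x ⟨
    (p ∙ x ^ₙ n) ∙ x   ≈⟨ ∙-congʳ (^ℕ-intertwine px≈yp n) ⟩
    (y ^ₙ n ∙ p) ∙ x   ≈⟨ assoc _ p x ⟩
    y ^ₙ n ∙ (p ∙ x)   ≈⟨ ∙-congˡ px≈yp ⟩
    y ^ₙ n ∙ (y ∙ p)   ≈⟨ assoc _ y p ⟨
    (y ^ₙ n ∙ y) ∙ p   ∎

  ⁻¹-^ℕ : ∀ x n → (x ⁻¹) ^ₙ n ≈ (x ^ₙ n) ⁻¹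
  ⁻¹-^ℕ x ℕ.zero = ≈-sym ε⁻¹≈ε
  ⁻¹-^ℕ x (ℕ.suc n) = begin
    (x ⁻¹) ^ₙ n ∙ x ⁻¹ ≈⟨ ∙-congʳ (⁻¹-^ℕ x n) ⟩
    (x ^ₙ n) ⁻¹ ∙ x ⁻¹ ≈⟨ ⁻¹-anti-homo-∙ x (x ^ₙ n) ⟨
    (x ∙ x ^ₙ n) ⁻¹    ≈⟨ ⁻¹-cong (^ℕ-intertwine (Group.refl G) n) ⟩
    (x ^ₙ n ∙ x) ⁻¹    ∎

  inverts-^ℕ : ∀ {p x} → Inverts p x → ∀ n → Inverts p (x ^ₙ n)
  inverts-^ℕ {p} {x} px≈x⁻¹p n = begin
    p ∙ x ^ₙ n         ≈⟨ ^ℕ-intertwine px≈x⁻¹p n ⟩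
    (x ⁻¹) ^ₙ n ∙ p    ≈⟨ ∙-congʳ (⁻¹-^ℕ x n) ⟩
    (x ^ₙ n) ⁻¹ ∙ p    ∎

  inverts-⁻¹ : ∀ {p x} → Inverts p x → Inverts p (x ⁻¹)
  inverts-⁻¹ {p} {x} px≈x⁻¹p = begin
    p ∙ x ⁻¹                 ≈⟨ \\-leftDividesˡ x (p ∙ x ⁻¹) ⟨
    x ∙ (x ⁻¹ ∙ (p ∙ x ⁻¹))  ≈⟨ ∙-congˡ (assoc (x ⁻¹) p (x ⁻¹)) ⟨
    x ∙ ((x ⁻¹ ∙ p) ∙ x ⁻¹)  ≈⟨ ∙-congˡ (∙-congʳ px≈x⁻¹p) ⟨
    x ∙ ((p ∙ x) ∙ x ⁻¹)     ≈⟨ ∙-congˡ (//-rightDividesʳ x p) ⟩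
    x ∙ p                    ≈⟨ ∙-congʳ (⁻¹-involutive x) ⟨
    x ⁻¹ ⁻¹ ∙ p              ∎

  inverts-^ℤ : ∀ {p x} → Inverts p x → ∀ q → Inverts p (_^ℤ_ G x q)
  inverts-^ℤ px≈x⁻¹p (+ n)    = inverts-^ℕ px≈x⁻¹p n
  inverts-^ℤ px≈x⁻¹p -[1+ n ] = inverts-^ℕ (inverts-⁻¹ px≈x⁻¹p) (ℕ.suc n)

  involution-⁻¹ : ∀ {p} → p ∙ p ≈ ε → p ⁻¹ ≈ p
  involution-⁻¹ {p} pp≈ε = ≈-sym (inverseˡ-unique p p pp≈ε)

  ∙-⁻¹-involutions : ∀ {a b} → a ∙ a ≈ ε → b ∙ b ≈ ε → (a ∙ b) ⁻¹ ≈ b ∙ a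
  ∙-⁻¹-involutions {a} {b} aa≈ε bb≈ε = begin
    (a ∙ b) ⁻¹    ≈⟨ ⁻¹-anti-homo-∙ a b ⟩
    b ⁻¹ ∙ a ⁻¹   ≈⟨ ∙-cong (involution-⁻¹ bb≈ε) (involution-⁻¹ aa≈ε) ⟩
    b ∙ a         ∎

  involution-inverts-∙ˡ : ∀ {a b} → a ∙ a ≈ ε → b ∙ b ≈ ε → Inverts a (a ∙ b)
  involution-inverts-∙ˡ {a} {b} aa≈ε bb≈ε = begin
    a ∙ (a ∙ b)       ≈⟨ assoc a a b ⟨
    (a ∙ a) ∙ b       ≈⟨ ∙-congʳ aa≈ε ⟩
    ε ∙ b             ≈⟨ identityˡ b ⟩
    b                 ≈⟨ identityʳ b ⟨
    b ∙ ε             ≈⟨ ∙-congˡ aa≈ε ⟨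
    b ∙ (a ∙ a)       ≈⟨ assoc b a a ⟨
    (b ∙ a) ∙ a       ≈⟨ ∙-congʳ (∙-⁻¹-involutions aa≈ε bb≈ε) ⟨
    (a ∙ b) ⁻¹ ∙ a    ∎

  involution-inverts-∙ʳ : ∀ {a b} → a ∙ a ≈ ε → b ∙ b ≈ ε → Inverts b (a ∙ b)
  involution-inverts-∙ʳ {a} {b} aa≈ε bb≈ε = begin
    b ∙ (a ∙ b)       ≈⟨ assoc b a b ⟨
    (b ∙ a) ∙ b       ≈⟨ ∙-congʳ (∙-⁻¹-involutions aa≈ε bb≈ε) ⟨
    (a ∙ b) ⁻¹ ∙ b    ∎

sharedRank : Fin 2 → Fin 3
sharedRank zero       = suc (suc zero)
sharedRank (suc zero) = zero

module _ {c ℓ} (Γ : StringCGroup3 c ℓ) where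
  open StringCGroup3 Γ using (group; ρ; ρ-invol)

  ρ-inverts-ρρ : ∀ i j → j ≢ sharedRank i → Inverts group (ρ j) (ρρ Γ i)
  ρ-inverts-ρρ zero       zero             _   = involution-inverts-∙ˡ group (ρ-invol _) (ρ-invol _)
  ρ-inverts-ρρ zero       (suc zero)       _   = involution-inverts-∙ʳ group (ρ-invol _) (ρ-invol _)
  ρ-inverts-ρρ zero       (suc (suc zero)) j≢k = ⊥-elim (j≢k refl)
  ρ-inverts-ρρ (suc zero) zero             j≢k = ⊥-elim (j≢k refl)
  ρ-inverts-ρρ (suc zero) (suc zero)       _   = involution-inverts-∙ˡ group (ρ-invol _) (ρ-invol _)
  ρ-inverts-ρρ (suc zero) (suc (suc zero)) _   = involution-inverts-∙ʳ group (ρ-invol _) (ρ-invol _)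

module _ {a b} (Q : AbstractPolyhedron a b) where
  open AbstractPolyhedron Q
  open IsPolyhedron isPolyhedron
  open IsPartialOrder isPartialOrder using () renaming (trans to ≤-trans)

  ≈F-isEquivalence : IsEquivalence (_≈F_ poset)
  ≈F-isEquivalence = record
    { refl  = λ _ → refl
    ; sym   = λ Ψ≈Ω j → sym (Ψ≈Ω j)
    ; trans = λ Ψ≈Ω Ω≈Θ j → trans (Ψ≈Ω j) (Ω≈Θ j)
    }

  ≈F-setoid : Setoid (a ⊔ b) a
  ≈F-setoid = record { isEquivalence = ≈F-isEquivalence }

  rank-faceOf : ∀ Ψ j → rank (faceOf poset Ψ j) ≡ + toℕ j
  rank-faceOf Ψ zero             = rank-vertex Ψ
  rank-faceOf Ψ (suc zero)       = rank-edge Ψ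
  rank-faceOf Ψ (suc (suc zero)) = rank-face Ψ

  InFlag-faceOf : ∀ Ψ j → InFlag poset Ψ (faceOf poset Ψ j)
  InFlag-faceOf Ψ zero             = inj₂ (inj₁ refl)
  InFlag-faceOf Ψ (suc zero)       = inj₂ (inj₂ (inj₁ refl))
  InFlag-faceOf Ψ (suc (suc zero)) = inj₂ (inj₂ (inj₂ (inj₁ refl)))

  faceOf-rank-injective : ∀ Ψ j k → rank (faceOf poset Ψ j) ≡ + toℕ k →
                          faceOf poset Ψ k ≡ faceOf poset Ψ j
  faceOf-rank-injective Ψ j k e =
    cong (faceOf poset Ψ) (sym (toℕ-injective (+-injective (trans (sym (rank-faceOf Ψ j)) e))))

  InFlag-rank-unique : ∀ Ψ k {H} → InFlag poset Ψ H → rank H ≡ + toℕ k → faceOf poset Ψ k ≡ H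
  InFlag-rank-unique Ψ k (inj₁ refl) e with () ← trans (sym rank-least) e
  InFlag-rank-unique Ψ k (inj₂ (inj₁ refl)) e = faceOf-rank-injective Ψ zero k e
  InFlag-rank-unique Ψ k (inj₂ (inj₂ (inj₁ refl))) e = faceOf-rank-injective Ψ (suc zero) k e
  InFlag-rank-unique Ψ k (inj₂ (inj₂ (inj₂ (inj₁ refl)))) e =
    faceOf-rank-injective Ψ (suc (suc zero)) k e
  InFlag-rank-unique Ψ k (inj₂ (inj₂ (inj₂ (inj₂ refl)))) e =
    ⊥-elim (<-irrefl (sym (+-injective (trans (sym rank-greatest) e))) (toℕ<n k))

  SharedFace⇒faceOf≡ : ∀ i {Ψ Ω} → SharedFace Q i Ψ Ω →
                       faceOf poset Ψ (sharedRank i) ≡ faceOf poset Ω (sharedRank i)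
  SharedFace⇒faceOf≡ zero       shared = shared
  SharedFace⇒faceOf≡ (suc zero) shared = shared

  Covers : Face → Face → Face → Set b
  Covers F G H = F ≤ H × H ≤ G × rank H ≡ rank F ℤ.+ 1ℤ

  diamond-third : ∀ {F G X Y Z} → F ≤ G → rank G ≡ rank F ℤ.+ + 2 →
                  Covers F G X → Covers F G Y → Covers F G Z → X ≢ Y → X ≢ Z → Y ≡ Z
  diamond-third F≤G rank-G (X₁ , X₂ , X₃) (Y₁ , Y₂ , Y₃) (Z₁ , Z₂ , Z₃) X≢Y X≢Z
    with diamond F≤G rank-G
  ... | _ , _ , _ , _ , _ , only-two
    with only-two _ X₁ X₂ X₃ | only-two _ Y₁ Y₂ Y₃ | only-two _ Z₁ Z₂ Z₃
  ... | inj₁ refl | inj₁ refl | _         = ⊥-elim (X≢Y refl)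
  ... | inj₂ refl | inj₂ refl | _         = ⊥-elim (X≢Y refl)
  ... | inj₁ refl | _         | inj₁ refl = ⊥-elim (X≢Z refl)
  ... | inj₂ refl | _         | inj₂ refl = ⊥-elim (X≢Z refl)
  ... | inj₁ refl | inj₂ refl | inj₂ refl = refl
  ... | inj₂ refl | inj₁ refl | inj₁ refl = refl

  faceBelow faceAbove : Flag poset → Fin 3 → Face
  faceBelow Ψ zero             = least
  faceBelow Ψ (suc zero)       = vertex Ψ
  faceBelow Ψ (suc (suc zero)) = edge Ψ
  faceAbove Ψ zero             = edge Ψ
  faceAbove Ψ (suc zero)       = face Ψ
  faceAbove Ψ (suc (suc zero)) = greatest

  private
    rank-shift : ∀ {F H} d {r} → rank F ≡ r → rank H ≡ r ℤ.+ d → rank H ≡ rank F ℤ.+ d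
    rank-shift d rank-F rank-H = trans rank-H (cong (ℤ._+ d) (sym rank-F))

  faceOf-covers : ∀ Ψ j → Covers (faceBelow Ψ j) (faceAbove Ψ j) (faceOf poset Ψ j)
  faceOf-covers Ψ zero =
    least-≤ _ , vertex≤edge Ψ , rank-shift 1ℤ rank-least (rank-vertex Ψ)
  faceOf-covers Ψ (suc zero) =
    vertex≤edge Ψ , edge≤face Ψ , rank-shift 1ℤ (rank-vertex Ψ) (rank-edge Ψ)
  faceOf-covers Ψ (suc (suc zero)) =
    edge≤face Ψ , ≤-greatest _ , rank-shift 1ℤ (rank-edge Ψ) (rank-face Ψ)

  rank-faceAbove : ∀ Ψ j → rank (faceAbove Ψ j) ≡ rank (faceBelow Ψ j) ℤ.+ + 2
  rank-faceAbove Ψ zero             = rank-shift (+ 2) rank-least (rank-edge Ψ)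
  rank-faceAbove Ψ (suc zero)       = rank-shift (+ 2) (rank-vertex Ψ) (rank-face Ψ)
  rank-faceAbove Ψ (suc (suc zero)) = rank-shift (+ 2) (rank-edge Ψ) rank-greatest

  faceBelow≤faceAbove : ∀ Ψ j → faceBelow Ψ j ≤ faceAbove Ψ j
  faceBelow≤faceAbove Ψ j = ≤-trans (proj₁ c) (proj₁ (proj₂ c))
    where c = faceOf-covers Ψ j

  faceBelow-Adj : ∀ {j Ψ Ω} → Adj poset j Ψ Ω → faceBelow Ω j ≡ faceBelow Ψ j
  faceBelow-Adj {zero}           _     = refl
  faceBelow-Adj {suc zero}       Ψ~Ω = sym (proj₂ Ψ~Ω zero λ ())
  faceBelow-Adj {suc (suc zero)} Ψ~Ω = sym (proj₂ Ψ~Ω (suc zero) λ ())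

  faceAbove-Adj : ∀ {j Ψ Ω} → Adj poset j Ψ Ω → faceAbove Ω j ≡ faceAbove Ψ j
  faceAbove-Adj {zero}           Ψ~Ω = sym (proj₂ Ψ~Ω (suc zero) λ ())
  faceAbove-Adj {suc zero}       Ψ~Ω = sym (proj₂ Ψ~Ω (suc (suc zero)) λ ())
  faceAbove-Adj {suc (suc zero)} _     = refl

  Adj-covers : ∀ {j Ψ Ω} → Adj poset j Ψ Ω →
               Covers (faceBelow Ψ j) (faceAbove Ψ j) (faceOf poset Ω j)
  Adj-covers {j} {Ω = Ω} Ψ~Ω =
    subst₂ (λ F G → Covers F G (faceOf poset Ω j))
      (faceBelow-Adj Ψ~Ω) (faceAbove-Adj Ψ~Ω) (faceOf-covers Ω j)

  Adj-unique : ∀ {j Ψ Ω Θ} → Adj poset j Ψ Ω → Adj poset j Ψ Θ → _≈F_ poset Ω Θ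
  Adj-unique {j} {Ψ} Ψ~Ω Ψ~Θ k with k ≟ j
  ... | yes refl =
    diamond-third (faceBelow≤faceAbove Ψ j) (rank-faceAbove Ψ j) (faceOf-covers Ψ j)
      (Adj-covers Ψ~Ω) (Adj-covers Ψ~Θ) (proj₁ Ψ~Ω) (proj₁ Ψ~Θ)
  ... | no k≢j = trans (sym (proj₂ Ψ~Ω k k≢j)) (proj₂ Ψ~Θ k k≢j)

module _ {a b c ℓ} {Q : AbstractPolyhedron a b} {Γ : StringCGroup3 c ℓ}
         (A : FlagAction Q Γ) where
  open AbstractPolyhedron Q using (poset; Face; rank)
  open StringCGroup3 Γ using (_≈_; _∙_; _⁻¹; ε; ρ; group; inverseʳ) renaming (refl to ≈-refl)
  open GroupProperties group using (//-rightDividesˡ)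
  open FlagAction A
  open SetoidReasoning (≈F-setoid Q)

  private
    _≈ᶠ_ : Flag poset → Flag poset → Set a
    _≈ᶠ_ = _≈F_ poset

  act-congˡ : ∀ Ψ {g h} → g ≈ h → (Ψ ^ g) ≈ᶠ (Ψ ^ h)
  act-congˡ Ψ g≈h = act-cong (λ _ → refl) g≈h

  act-congʳ : ∀ {Ψ Ω} g → Ψ ≈ᶠ Ω → (Ψ ^ g) ≈ᶠ (Ω ^ g)
  act-congʳ g Ψ≈Ω = act-cong Ψ≈Ω ≈-refl

  Stab-resp : ∀ {Ψ Ω x} → Ψ ≈ᶠ Ω → Stab A Ψ x → Stab A Ω x
  Stab-resp {Ψ} {Ω} {x} Ψ≈Ω Ψx≈Ψ = begin
    Ω ^ x  ≈⟨ act-congʳ x Ψ≈Ω ⟨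
    Ψ ^ x  ≈⟨ Ψx≈Ψ ⟩
    Ψ      ≈⟨ Ψ≈Ω ⟩
    Ω      ∎

  Stab-⁻¹ : ∀ {Ψ x} → Stab A Ψ x → Stab A Ψ (x ⁻¹)
  Stab-⁻¹ {Ψ} {x} Ψx≈Ψ = begin
    Ψ ^ (x ⁻¹)         ≈⟨ act-congʳ (x ⁻¹) Ψx≈Ψ ⟨
    (Ψ ^ x) ^ (x ⁻¹)   ≈⟨ act-∙ Ψ x (x ⁻¹) ⟨
    Ψ ^ (x ∙ x ⁻¹)     ≈⟨ act-congˡ Ψ (inverseʳ x) ⟩
    Ψ ^ ε              ≈⟨ act-ε Ψ ⟩
    Ψ                  ∎

  Stab-conj⇒ : ∀ {Φ} w {x} → Stab A Φ ((w ∙ x) ∙ w ⁻¹) → Stab A (Φ ^ w) x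
  Stab-conj⇒ {Φ} w {x} fixes = begin
    (Φ ^ w) ^ x                   ≈⟨ act-∙ Φ w x ⟨
    Φ ^ (w ∙ x)                   ≈⟨ act-congˡ Φ (//-rightDividesˡ w (w ∙ x)) ⟨
    Φ ^ (((w ∙ x) ∙ w ⁻¹) ∙ w)    ≈⟨ act-∙ Φ _ w ⟩
    (Φ ^ ((w ∙ x) ∙ w ⁻¹)) ^ w    ≈⟨ act-congʳ w fixes ⟩
    Φ ^ w                         ∎

  Stab-conj⇐ : ∀ {Φ} w {x} → Stab A (Φ ^ w) x → Stab A Φ ((w ∙ x) ∙ w ⁻¹)
  Stab-conj⇐ {Φ} w {x} fixes = begin
    Φ ^ ((w ∙ x) ∙ w ⁻¹)     ≈⟨ act-∙ Φ (w ∙ x) (w ⁻¹) ⟩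
    (Φ ^ (w ∙ x)) ^ (w ⁻¹)   ≈⟨ act-congʳ (w ⁻¹) (act-∙ Φ w x) ⟩
    ((Φ ^ w) ^ x) ^ (w ⁻¹)   ≈⟨ act-congʳ (w ⁻¹) fixes ⟩
    (Φ ^ w) ^ (w ⁻¹)         ≈⟨ act-∙ Φ w (w ⁻¹) ⟨
    Φ ^ (w ∙ w ⁻¹)           ≈⟨ act-congˡ Φ (inverseʳ w) ⟩
    Φ ^ ε                    ≈⟨ act-ε Φ ⟩
    Φ                        ∎

  Stab-ρ : ∀ {Ψ x} j → Inverts group (ρ j) x → Stab A Ψ x → Stab A (Ψ ^ ρ j) x
  Stab-ρ {Ψ} {x} j ρx≈x⁻¹ρ Ψx≈Ψ = begin
    (Ψ ^ ρ j) ^ x          ≈⟨ act-∙ Ψ (ρ j) x ⟨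
    Ψ ^ (ρ j ∙ x)          ≈⟨ act-congˡ Ψ ρx≈x⁻¹ρ ⟩
    Ψ ^ (x ⁻¹ ∙ ρ j)       ≈⟨ act-∙ Ψ (x ⁻¹) (ρ j) ⟩
    (Ψ ^ (x ⁻¹)) ^ ρ j     ≈⟨ act-congʳ (ρ j) (Stab-⁻¹ Ψx≈Ψ) ⟩
    Ψ ^ ρ j                ∎

  Stab-Adj : ∀ {j Ψ Ω x} → Adj poset j Ψ Ω → Inverts group (ρ j) x → Stab A Ψ x → Stab A Ω x
  Stab-Adj {j} {Ψ} Ψ~Ω ρx≈x⁻¹ρ Ψx≈Ψ =
    Stab-resp (Adj-unique Q (act-ρ Ψ j) Ψ~Ω) (Stab-ρ j ρx≈x⁻¹ρ Ψx≈Ψ)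

  Stab-along-FlagPath : ∀ {x k F} {S : Face → Set a} →
    (∀ j → j ≢ k → Inverts group (ρ j) x) → rank F ≡ + toℕ k → S F →
    ∀ {Ψ Ω} → FlagPath poset S Ψ Ω → InFlag poset Ψ F → Stab A Ψ x → Stab A Ω x
  Stab-along-FlagPath _ _ _ (done Ψ≈Ω) _ Ψx≈Ψ = Stab-resp Ψ≈Ω Ψx≈Ψ
  Stab-along-FlagPath {k = k} {F} inverts rank-F S-F {Ψ}
                      (step {Ψ' = Ψ'} j Ψ~Ψ' keeps-S rest) F∈Ψ Ψx≈Ψ =
    Stab-along-FlagPath inverts rank-F S-F rest F∈Ψ' (Stab-Adj Ψ~Ψ' (inverts j j≢k) Ψx≈Ψ)
    where
    F∈Ψ' : InFlag poset Ψ' F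
    F∈Ψ' = keeps-S F S-F
    j≢k : j ≢ k
    j≢k refl = proj₁ Ψ~Ψ' (trans (InFlag-rank-unique Q Ψ j F∈Ψ rank-F)
                                 (sym (InFlag-rank-unique Q Ψ' j F∈Ψ' rank-F)))

lemma3p5 : ∀ {a b c ℓ} (Q : AbstractPolyhedron a b) (Γ : StringCGroup3 c ℓ)
    (A : FlagAction Q Γ) (Φ : Flag (AbstractPolyhedron.poset Q))
    (i : Fin 2) (q : ℤ) (w : StringCGroup3.Carrier Γ) →
    Stab A Φ (StringCGroup3._∙_ Γ (StringCGroup3._∙_ Γ w (_^ℤ_ (StringCGroup3.group Γ) (ρρ Γ i) q)) (StringCGroup3._⁻¹ Γ w)) →
    ∀ (w' : StringCGroup3.Carrier Γ) →
    SharedFace Q i (FlagAction._^_ A Φ w') (FlagAction._^_ A Φ w) →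
    Stab A Φ (StringCGroup3._∙_ Γ (StringCGroup3._∙_ Γ w' (_^ℤ_ (StringCGroup3.group Γ) (ρρ Γ i) q)) (StringCGroup3._⁻¹ Γ w'))
lemma3p5 Q Γ A Φ i q w fixes w' shared =
  Stab-conj⇐ A w' (Stab-along-FlagPath A ρ-inverts-power (rank-faceOf Q Φw k) (F∈Φw , F∈Φw')
    (stronglyFlagConnected Φw Φw') F∈Φw (Stab-conj⇒ A w fixes))
  where
  open AbstractPolyhedron Q using (poset; isPolyhedron)
  open IsPolyhedron isPolyhedron using (stronglyFlagConnected)
  open StringCGroup3 Γ using (group; ρ)
  open FlagAction A using (_^_)

  k : Fin 3
  k = sharedRank i

  Φw Φw' : Flag poset
  Φw  = Φ ^ w
  Φw' = Φ ^ w'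

  ρ-inverts-power : ∀ j → j ≢ k → Inverts group (ρ j) (_^ℤ_ group (ρρ Γ i) q)
  ρ-inverts-power j j≢k = inverts-^ℤ group (ρ-inverts-ρρ Γ i j j≢k) q

  F∈Φw : InFlag poset Φw (faceOf poset Φw k)
  F∈Φw = InFlag-faceOf Q Φw k

  F∈Φw' : InFlag poset Φw' (faceOf poset Φw k)
  F∈Φw' = subst (InFlag poset Φw') (SharedFace⇒faceOf≡ Q i shared) (InFlag-faceOf Q Φw' k)
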